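{- Let $T$ be a tree of order $n$ and let $T'$ be a graph which is not a tree. Then $D(T,T')\le\log_2n+3$.
   Context: $D(G,G')$ is the smallest quantifier depth of a first order sentence (variables over vertices, connectives, quantifiers, equality, adjacency) which is true in $G$ and false in $G'$; equivalently, the smallest $k$ such that Spoiler wins the $k$-round Ehrenfeucht game on $(G,G')$. All graphs are finite. -}

module Defs where

open import Data.Nat using (ℕ; zero; suc; _≤_; _+_)
open import Data.Fin using (Fin; zero; suc; inject₁; fromℕ)
open import Data.Bool using (Bool; T)
open import Data.Product using (Σ; _×_; ∃)
open import Data.Sum using (_⊎_)
open import Data.Empty using (⊥)
open import Relation.Nullary using (¬_)
open import Relation.Binary.PropositionalEquality using (_≡_)
open import Function.Definitions using (Injective)

record Graph : Set where
  field
    order : ℕ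
    adj   : Fin order → Fin order → Bool
    sym   : ∀ u v → adj u v ≡ adj v u
    irrefl : ∀ v → ¬ T (adj v v)

open Graph public

Vertex : Graph → Set
Vertex G = Fin (order G)

Adj : (G : Graph) → Vertex G → Vertex G → Set
Adj G u v = T (adj G u v)

data Walk (G : Graph) : Vertex G → Vertex G → Set where
  here : ∀ {v} → Walk G v v
  step : ∀ {u v w} → Adj G u v → Walk G v w → Walk G u w

Connected : Graph → Set
Connected G = ∀ (u v : Vertex G) → Walk G u v

record Cycle (G : Graph) : Set where
  field
    len-3  : ℕ
    vert   : Fin (suc (suc (suc len-3))) → Vertex G
    inj    : Injective _≡_ _≡_ vert
    edges  : ∀ (i : Fin (suc (suc len-3))) → Adj G (vert (inject₁ i)) (vert (suc i))
    closes : Adj G (vert (fromℕ (suc (suc len-3)))) (vert zero)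

Acyclic : Graph → Set
Acyclic G = ¬ Cycle G

IsTree : Graph → Set
IsTree G = (1 ≤ order G) × Connected G × Acyclic G

-- First-order logic of graphs: formulas with k free variables
-- (de Bruijn style), built from equality and adjacency atoms,
-- connectives and quantifiers over vertices.

data Formula : ℕ → Set where
  eq   : ∀ {k} → Fin k → Fin k → Formula k
  adjF : ∀ {k} → Fin k → Fin k → Formula k
  ⊤F   : ∀ {k} → Formula k
  ⊥F   : ∀ {k} → Formula k
  ¬F   : ∀ {k} → Formula k → Formula k
  _∧F_ : ∀ {k} → Formula k → Formula k → Formula k
  _∨F_ : ∀ {k} → Formula k → Formula k → Formula k
  _⇒F_ : ∀ {k} → Formula k → Formula k → Formula k
  ∃F   : ∀ {k} → Formula (suc k) → Formula k
  ∀F   : ∀ {k} → Formula (suc k) → Formula k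

Sentence : Set
Sentence = Formula 0

open import Data.Nat using (_⊔_)

depth : ∀ {k} → Formula k → ℕ
depth (eq _ _)   = 0
depth (adjF _ _) = 0
depth ⊤F         = 0
depth ⊥F         = 0
depth (¬F φ)     = depth φ
depth (φ ∧F ψ)   = depth φ ⊔ depth ψ
depth (φ ∨F ψ)   = depth φ ⊔ depth ψ
depth (φ ⇒F ψ)   = depth φ ⊔ depth ψ
depth (∃F φ)     = suc (depth φ)
depth (∀F φ)     = suc (depth φ)

extend : ∀ {A : Set} {k} → A → (Fin k → A) → Fin (suc k) → A
extend a ρ zero    = a
extend a ρ (suc i) = ρ i

open import Data.Unit using (⊤)

Sat : ∀ (G : Graph) {k} → Formula k → (Fin k → Vertex G) → Set
Sat G (eq i j)   ρ = ρ i ≡ ρ j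
Sat G (adjF i j) ρ = Adj G (ρ i) (ρ j)
Sat G ⊤F         ρ = ⊤
Sat G ⊥F         ρ = ⊥
Sat G (¬F φ)     ρ = ¬ Sat G φ ρ
Sat G (φ ∧F ψ)   ρ = Sat G φ ρ × Sat G ψ ρ
Sat G (φ ∨F ψ)   ρ = Sat G φ ρ ⊎ Sat G ψ ρ
Sat G (φ ⇒F ψ)   ρ = Sat G φ ρ → Sat G ψ ρ
Sat G (∃F φ)     ρ = Σ (Vertex G) λ v → Sat G φ (extend v ρ)
Sat G (∀F φ)     ρ = ∀ (v : Vertex G) → Sat G φ (extend v ρ)

emptyEnv : ∀ {A : Set} → Fin 0 → A
emptyEnv ()

_⊨_ : Graph → Sentence → Set
G ⊨ φ = Sat G φ emptyEnv

-- "D(G,G') ≤ d": some sentence of quantifier depth ≤ d is true in G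
-- and false in G'.  Since D is the least such depth, this is
-- exactly the inequality D(G,G') ≤ d.
D≤ : Graph → Graph → ℕ → Set
D≤ G G' d = Σ Sentence λ φ → (depth φ ≤ d) × (G ⊨ φ) × ¬ (G' ⊨ φ)

-- Let d = ⌊log₂ n⌋. "There is a walk of length ≤ m from x to y" has quantifier depth k as
-- soon as m ≤ 2 ^ k: guess a midpoint and recurse on both halves. The distinguishing sentence
-- says (i) some centre reaches every vertex within R = 2 ^ d − 1 steps (depth d + 2), and
-- (ii) no edge xy has a detour, an x–y walk of length ≤ 2 ^ (d + 1) avoiding xy (depth d + 3).
-- A tree satisfies (ii) because its edges are bridges, and (i) because its radius r satisfies
-- 2r ≤ n < 2 ^ (d + 1): for a centre c of eccentricity r, a vertex x₁ at distance r from c,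
-- the neighbour c′ of c towards x₁ and a vertex x₂ at distance ≥ r from c′, the path from x₁
-- to x₂ runs through c and so has at least 2r vertices. Conversely (i) makes a graph
-- connected, and with (ii) acyclic: on a cycle take the vertex x farthest from the centre c
-- and its cycle-neighbours a ≠ b; shortest paths from c to a and to b avoid x, so x a ⋯ c ⋯ b
-- is a detour of length ≤ 2R + 1 around xb.

module Submission where

open import Defs hiding (sym)
open import Level using (0ℓ)
open import Data.Nat
  using (ℕ; zero; suc; pred; _+_; _*_; _^_; _≤_; _<_; z≤n; s≤s; ⌊_/2⌋; ⌈_/2⌉; >-nonZero⁻¹)
open import Data.Nat.Properties
  using (≤-refl; ≤-reflexive; ≤-trans; <-≤-trans; ≤-<-trans; ≤-pred; <⇒≤; <⇒≤pred; <⇒≱;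
         ≰⇒>; 1+n≰n; n≤1+n; m≤n⇒m≤1+n; pred[n]≤n; +-comm; +-suc; +-identityʳ; +-mono-≤;
         +-monoʳ-≤; *-cancelˡ-<; m^n>0; ⊔-lub; ⌊n/2⌋≤⌈n/2⌉; ⌊n/2⌋+⌈n/2⌉≡n; ⌈n/2⌉-mono;
         n≡⌈n+n/2⌉; module ≤-Reasoning)
open import Data.Nat.Logarithm using (⌊log₂_⌋; ⌊log₂⌋-mono-≤; ⌊log₂[2^n]⌋≡n)
open import Data.Fin using (Fin; zero; suc; inject₁; fromℕ; fromℕ<; _≟_)
open import Data.Fin.Properties
  using (any?; all?; ¬∀⟶∃¬; injective⇒≤; suc-injective; nonZeroIndex)
open import Data.Fin.Relation.Unary.Top using (view; ‵fromℕ; ‵inj₁)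
open import Data.List.Base using (allFin)
open import Data.List.Extrema.Nat using (argmax; f[xs]≤f[argmax])
open import Data.List.Membership.Propositional.Properties using (∈-allFin)
import Data.List.Relation.Unary.All as All
open import Data.Bool using (T)
open import Data.Product using (Σ; ∃; _×_; _,_; proj₁; proj₂)
open import Data.Product.Function.NonDependent.Propositional using (_×-⇔_)
open import Data.Product.Function.Dependent.Propositional using (congˡ)
open import Function.Related.Propositional using (equivalence)
open import Data.Sum using (_⊎_; inj₁; inj₂; [_,_])
open import Data.Sum.Function.Propositional using (_⊎-⇔_)
open import Data.Unit using (⊤; tt)
open import Data.Empty using (⊥-elim)
open import Function using (id; _∘_; _⇔_; mk⇔; Equivalence)
open import Function.Definitions using (Injective)
open import Function.Related.TypeIsomorphisms using (→-cong-⇔; ¬-cong-⇔)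
open import Function.Properties.Equivalence
  using () renaming (refl to ⇔-refl; sym to ⇔-sym; trans to ⇔-trans)
open import Relation.Binary.Core using (Rel; _⇒_)
open import Relation.Binary.Definitions using (Sym; Decidable)
open import Relation.Binary.Construct.Closure.ReflexiveTransitive
  using (Star; ε; _◅_; _◅◅_; revApp; reverse)
open import Relation.Binary.PropositionalEquality using (_≡_; _≢_; refl; sym; trans; cong; subst)
open import Relation.Nullary using (¬_; Dec; yes; no; T?)
open import Relation.Nullary.Decidable as Dec using (_×-dec_; _⊎-dec_; decidable-stable)
open import Relation.Unary as U using (Pred)

open Equivalence using (to; from)
open Cycle using (len-3; vert; inj; edges; closes)

record Minimum (P : Pred ℕ 0ℓ) : Set where
  field
    min   : ℕ
    holds : P min
    least : ∀ {m} → P m → min ≤ m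

open Minimum

minimum : ∀ {P : Pred ℕ 0ℓ} → U.Decidable P → (∀ {m n} → m ≤ n → P m → P n) →
          ∀ {m} → P m → Minimum P
minimum P? mono {zero}  p = record { min = 0 ; holds = p ; least = λ _ → z≤n }
minimum P? mono {suc m} p with P? m
... | yes q = minimum P? mono q
... | no ¬q = record { min = suc m ; holds = p ; least = λ pn → ≰⇒> λ n≤m → ¬q (mono n≤m pn) }

∀-cong-⇔ : ∀ {A : Set} {P Q : A → Set} → (∀ x → P x ⇔ Q x) → (∀ x → P x) ⇔ (∀ x → Q x)
∀-cong-⇔ P⇔Q = mk⇔ (λ p x → to (P⇔Q x) (p x)) (λ q x → from (P⇔Q x) (q x))

m≤2^[1+k]⇒⌈m/2⌉≤2^k : ∀ k {m} → m ≤ 2 ^ suc k → ⌈ m /2⌉ ≤ 2 ^ k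
m≤2^[1+k]⇒⌈m/2⌉≤2^k k {m} m≤2^[1+k] = begin
  ⌈ m /2⌉             ≤⟨ ⌈n/2⌉-mono (subst (m ≤_) 2^[1+k]≡2^k+2^k m≤2^[1+k]) ⟩
  ⌈ 2 ^ k + 2 ^ k /2⌉ ≡⟨ sym (n≡⌈n+n/2⌉ (2 ^ k)) ⟩
  2 ^ k               ∎
  where
  open ≤-Reasoning
  2^[1+k]≡2^k+2^k : 2 ^ suc k ≡ 2 ^ k + 2 ^ k
  2^[1+k]≡2^k+2^k = cong (2 ^ k +_) (+-identityʳ (2 ^ k))

n<2^[1+⌊log₂n⌋] : ∀ n → n < 2 ^ suc ⌊log₂ n ⌋
n<2^[1+⌊log₂n⌋] n = ≰⇒> λ 2^[1+⌊log₂n⌋]≤n →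
  1+n≰n (subst (_≤ ⌊log₂ n ⌋) (⌊log₂[2^n]⌋≡n (suc ⌊log₂ n ⌋))
               (⌊log₂⌋-mono-≤ 2^[1+⌊log₂n⌋]≤n))

2*m≤n⇒m≤pred[2^⌊log₂n⌋] : ∀ {m n} → 2 * m ≤ n → m ≤ pred (2 ^ ⌊log₂ n ⌋)
2*m≤n⇒m≤pred[2^⌊log₂n⌋] {m} {n} 2m≤n =
  <⇒≤pred (*-cancelˡ-< 2 m (2 ^ ⌊log₂ n ⌋) (≤-<-trans 2m≤n (n<2^[1+⌊log₂n⌋] n)))

1+2*pred[n]≤2*n : ∀ {n} → 0 < n → suc (pred n + pred n) ≤ 2 * n
1+2*pred[n]≤2*n {suc n} _ =
  s≤s (+-monoʳ-≤ n (≤-trans (n≤1+n n) (≤-reflexive (sym (+-identityʳ (suc n))))))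

suc²≢inject₁² : ∀ {n} (i : Fin n) → suc (suc i) ≢ inject₁ (inject₁ i)
suc²≢inject₁² zero    ()
suc²≢inject₁² (suc i) same = suc²≢inject₁² i (suc-injective same)

module _ {N : ℕ} {E : Rel (Fin N) 0ℓ} where

  length : ∀ {s t} → Star E s t → ℕ
  length ε       = 0
  length (_ ◅ w) = suc (length w)

  length-◅◅ : ∀ {s t r} (w : Star E s t) (w′ : Star E t r) →
              length (w ◅◅ w′) ≡ length w + length w′
  length-◅◅ ε       w′ = refl
  length-◅◅ (_ ◅ w) w′ = cong suc (length-◅◅ w w′)

  length-revApp : (sym-E : Sym E E) → ∀ {s t r} (w : Star E t s) (w′ : Star E t r) →
                  length (revApp sym-E w w′) ≡ length w + length w′
  length-revApp sym-E ε       w′ = refl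
  length-revApp sym-E (e ◅ w) w′ =
    trans (length-revApp sym-E w (sym-E e ◅ w′)) (+-suc (length w) (length w′))

  length-reverse : (sym-E : Sym E E) → ∀ {s t} (w : Star E s t) →
                   length (reverse sym-E w) ≡ length w
  length-reverse sym-E w = trans (length-revApp sym-E w ε) (+-identityʳ (length w))

  Visits : ∀ {s t} → Star E s t → Fin N → Set
  Visits {s} ε       a = a ≡ s
  Visits {s} (_ ◅ w) a = a ≡ s ⊎ Visits w a

  visits? : ∀ {s t} (w : Star E s t) a → Dec (Visits w a)
  visits? {s} ε       a = a ≟ s
  visits? {s} (_ ◅ w) a = (a ≟ s) ⊎-dec visits? w a

  splitAt : ∀ {s t a} (w : Star E s t) → Visits w a →
            Σ (Star E s a) λ p → Σ (Star E a t) λ q → length p + length q ≡ length w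
  splitAt ε       refl        = ε , ε , refl
  splitAt (e ◅ w) (inj₁ refl) = ε , e ◅ w , refl
  splitAt (e ◅ w) (inj₂ a∈w)  =
    let p , q , |p|+|q| = splitAt w a∈w in e ◅ p , q , cong suc |p|+|q|

  suffix : ∀ {s t a} (w : Star E s t) → Visits w a → Σ (Star E a t) λ q → length q ≤ length w
  suffix ε       refl        = ε , z≤n
  suffix (e ◅ w) (inj₁ refl) = e ◅ w , ≤-refl
  suffix (e ◅ w) (inj₂ a∈w)  = let q , |q|≤|w| = suffix w a∈w in q , m≤n⇒m≤1+n |q|≤|w|

  proper-suffix : ∀ {s t a} → s ≢ a → (w : Star E s t) → Visits w a →
                  Σ (Star E a t) λ q → length q < length w
  proper-suffix s≢a ε       refl        = ⊥-elim (s≢a refl)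
  proper-suffix s≢a (e ◅ w) (inj₁ refl) = ⊥-elim (s≢a refl)
  proper-suffix s≢a (e ◅ w) (inj₂ a∈w)  = let q , |q|≤|w| = suffix w a∈w in q , s≤s |q|≤|w|

  proper-prefix : ∀ {s t a} → a ≢ t → (w : Star E s t) → Visits w a →
                  Σ (Star E s a) λ p → length p < length w
  proper-prefix a≢t ε       refl        = ⊥-elim (a≢t refl)
  proper-prefix a≢t (e ◅ w) (inj₁ refl) = ε , s≤s z≤n
  proper-prefix a≢t (e ◅ w) (inj₂ a∈w)  =
    let p , |p|<|w| = proper-prefix a≢t w a∈w in e ◅ p , s≤s |p|<|w|

  Simple : ∀ {s t} → Star E s t → Set
  Simple ε           = ⊤
  Simple {s} (_ ◅ w) = ¬ Visits w s × Simple w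

  simple-suffix : ∀ {s t a} (w : Star E s t) → Simple w → Visits w a → Σ (Star E a t) Simple
  simple-suffix ε       _            refl        = ε , tt
  simple-suffix (e ◅ w) simple       (inj₁ refl) = e ◅ w , simple
  simple-suffix (e ◅ w) (_ , simple) (inj₂ a∈w)  = simple-suffix w simple a∈w

  simplify : ∀ {s t} → Star E s t → Σ (Star E s t) Simple
  simplify ε = ε , tt
  simplify {s} (e ◅ w) with simplify w
  ... | w′ , simple with visits? w′ s
  ...   | yes s∈w′ = simple-suffix w′ simple s∈w′
  ...   | no  s∉w′ = e ◅ w′ , s∉w′ , simple

  vertexAt : ∀ {s t} (w : Star E s t) → Fin (suc (length w)) → Fin N
  vertexAt {s} w       zero    = s
  vertexAt     (_ ◅ w) (suc i) = vertexAt w i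

  vertexAt-visits : ∀ {s t} (w : Star E s t) i → Visits w (vertexAt w i)
  vertexAt-visits ε       zero    = refl
  vertexAt-visits (_ ◅ w) zero    = inj₁ refl
  vertexAt-visits (_ ◅ w) (suc i) = inj₂ (vertexAt-visits w i)

  vertexAt-injective : ∀ {s t} (w : Star E s t) → Simple w → Injective _≡_ _≡_ (vertexAt w)
  vertexAt-injective w       _            {zero}  {zero}  _    = refl
  vertexAt-injective (_ ◅ w) (s∉w , _)    {zero}  {suc j} same =
    ⊥-elim (s∉w (subst (Visits w) (sym same) (vertexAt-visits w j)))
  vertexAt-injective (_ ◅ w) (s∉w , _)    {suc i} {zero}  same =
    ⊥-elim (s∉w (subst (Visits w) same (vertexAt-visits w i)))
  vertexAt-injective (_ ◅ w) (_ , simple) {suc i} {suc j} same =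
    cong suc (vertexAt-injective w simple same)

  vertexAt-last : ∀ {s t} (w : Star E s t) → vertexAt w (fromℕ (length w)) ≡ t
  vertexAt-last ε       = refl
  vertexAt-last (_ ◅ w) = vertexAt-last w

  vertexAt-step : ∀ {s t} (w : Star E s t) (i : Fin (length w)) →
                  E (vertexAt w (inject₁ i)) (vertexAt w (suc i))
  vertexAt-step (e ◅ w) zero    = e
  vertexAt-step (_ ◅ w) (suc i) = vertexAt-step w i

  simple-length< : ∀ {s t} (w : Star E s t) → Simple w → length w < N
  simple-length< w simple = injective⇒≤ (vertexAt-injective w simple)

module _ {N : ℕ} {E E′ : Rel (Fin N) 0ℓ} {a : Fin N}
         (lift : ∀ {x y} → E x y → x ≢ a → y ≢ a → E′ x y) where

  restrict : ∀ {s t} (w : Star E s t) → ¬ Visits w a → Star E′ s t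
  restrict ε       _   = ε
  restrict (e ◅ w) a∉ =
    lift e (λ { refl → a∉ (inj₁ refl) }) (λ { refl → a∉ (inj₂ (vertexAt-visits w zero)) })
    ◅ restrict w (a∉ ∘ inj₂)

  length-restrict : ∀ {s t} (w : Star E s t) (a∉w : ¬ Visits w a) →
                    length (restrict w a∉w) ≡ length w
  length-restrict ε       _   = refl
  length-restrict (e ◅ w) a∉ = cong suc (length-restrict w (a∉ ∘ inj₂))

Reach : ∀ {N} → Rel (Fin N) 0ℓ → ℕ → Rel (Fin N) 0ℓ
Reach E m s t = Σ (Star E s t) λ w → length w ≤ m

module _ {N : ℕ} {E : Rel (Fin N) 0ℓ} where

  Reach-mono : ∀ {m n s t} → m ≤ n → Reach E m s t → Reach E n s t
  Reach-mono m≤n (w , |w|≤m) = w , ≤-trans |w|≤m m≤n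

  Reach-step : ∀ {m s z t} → E s z → Reach E m z t → Reach E (suc m) s t
  Reach-step e (w , |w|≤m) = e ◅ w , s≤s |w|≤m

  Reach-reverse : Sym E E → ∀ {m s t} → Reach E m s t → Reach E m t s
  Reach-reverse sym-E (w , |w|≤m) =
    reverse sym-E w , subst (_≤ _) (sym (length-reverse sym-E w)) |w|≤m

  Reach-zero : ∀ {s t} → Reach E 0 s t ⇔ s ≡ t
  Reach-zero = mk⇔ (λ { (ε , _) → refl }) (λ { refl → ε , z≤n })

  Reach-one : ∀ {s t} → Reach E 1 s t ⇔ (s ≡ t ⊎ E s t)
  Reach-one = mk⇔ (λ { (ε , _) → inj₁ refl ; (e ◅ ε , _) → inj₂ e ; (_ ◅ _ ◅ _ , s≤s ()) })
                  [ (λ { refl → ε , z≤n }) , (λ e → e ◅ ε , ≤-refl) ]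

  Reach-suc : ∀ {m s t} → Reach E (suc m) s t ⇔ (s ≡ t ⊎ ∃ λ z → E s z × Reach E m z t)
  Reach-suc = mk⇔ (λ { (ε , _) → inj₁ refl ; (e ◅ w , s≤s l) → inj₂ (_ , e , w , l) })
                  [ (λ { refl → ε , z≤n }) , (λ (_ , e , r) → Reach-step e r) ]

  Reach-+ : ∀ a {b s t} → Reach E (a + b) s t ⇔ ∃ λ z → Reach E a s z × Reach E b z t
  Reach-+ a = mk⇔ (split a) join
    where
    split : ∀ a {b s t} → Reach E (a + b) s t → ∃ λ z → Reach E a s z × Reach E b z t
    split zero    r              = _ , (ε , z≤n) , r
    split (suc a) (ε , _)        = _ , (ε , z≤n) , (ε , z≤n)
    split (suc a) (e ◅ w , s≤s l) = let z , p , q = split a (w , l) in z , Reach-step e p , q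
    join : ∀ {b s t} → (∃ λ z → Reach E a s z × Reach E b z t) → Reach E (a + b) s t
    join (_ , (p , |p|≤a) , (q , |q|≤b)) =
      p ◅◅ q , subst (_≤ _) (sym (length-◅◅ p q)) (+-mono-≤ |p|≤a |q|≤b)

  Reach-halves : ∀ m {s t} →
                 Reach E m s t ⇔ ∃ λ z → Reach E ⌊ m /2⌋ s z × Reach E ⌈ m /2⌉ z t
  Reach-halves m {s} {t} =
    subst (λ n → Reach E n s t ⇔ ∃ λ z → Reach E ⌊ m /2⌋ s z × Reach E ⌈ m /2⌉ z t)
          (⌊n/2⌋+⌈n/2⌉≡n m) (Reach-+ ⌊ m /2⌋)

  reach? : Decidable E → ∀ m → Decidable (Reach E m)
  reach? E? zero    s t = Dec.map (⇔-sym Reach-zero) (s ≟ t)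
  reach? E? (suc m) s t =
    Dec.map (⇔-sym Reach-suc) ((s ≟ t) ⊎-dec any? (λ z → E? s z ×-dec reach? E? m z t))

  Reach-uncons : ∀ {m s t} → Reach E (suc m) s t → ¬ Reach E m s t →
                 ∃ λ z → E s z × Reach E m z t
  Reach-uncons r s↛t = [ (λ { refl → ⊥-elim (s↛t (ε , z≤n)) }) , id ] (to Reach-suc r)

  Distance : Fin N → Fin N → Set
  Distance c y = Minimum (λ m → Reach E m c y)

  distance : Decidable E → ∀ {m c y} → Reach E m c y → Distance c y
  distance E? {c = c} {y} = minimum (λ m → reach? E? m c y) Reach-mono

  geodesic-avoids : ∀ {c x y} (dx : Distance c x) → x ≢ y → (w : Star E c y) →
                    length w ≤ min dx → ¬ Visits w x
  geodesic-avoids dx x≢y w |w|≤dx x∈w =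
    let p , |p|<|w| = proper-prefix x≢y w x∈w
    in <⇒≱ (<-≤-trans |p|<|w| |w|≤dx) (least dx (p , ≤-refl))

-- β u v x y says "x ~ y" in a graph that may depend on the two parameter variables u and v
-- (for detours: G with the edge uv deleted).
EdgeFormula : Set
EdgeFormula = ∀ {K} → Fin K → Fin K → Fin K → Fin K → Formula K

-- Only meaningful for m ≤ 2 ^ k: at depth 0 it cannot express walks of length ≥ 2.
ReachF : ℕ → ℕ → EdgeFormula → EdgeFormula
ReachF zero    zero    β u v x y = eq x y
ReachF zero    (suc _) β u v x y = eq x y ∨F β u v x y
ReachF (suc k) m       β u v x y =
  ∃F (ReachF k ⌊ m /2⌋ β (suc u) (suc v) (suc x) zero ∧F
      ReachF k ⌈ m /2⌉ β (suc u) (suc v) zero (suc y))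

depth-ReachF : ∀ {β : EdgeFormula} → (∀ {K} (u v x y : Fin K) → depth (β u v x y) ≡ 0) →
               ∀ k m {K} (u v x y : Fin K) → depth (ReachF k m β u v x y) ≤ k
depth-ReachF β₀ zero    zero    u v x y = z≤n
depth-ReachF β₀ zero    (suc m) u v x y = ≤-reflexive (β₀ u v x y)
depth-ReachF β₀ (suc k) m       u v x y =
  s≤s (⊔-lub (depth-ReachF β₀ k ⌊ m /2⌋ _ _ _ _) (depth-ReachF β₀ k ⌈ m /2⌉ _ _ _ _))

module _ (G : Graph) (β : EdgeFormula) (E : Vertex G → Vertex G → Rel (Vertex G) 0ℓ)
         (Sat-β : ∀ {K} (ρ : Fin K → Vertex G) u v x y →
                  Sat G (β u v x y) ρ ⇔ E (ρ u) (ρ v) (ρ x) (ρ y)) where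

  Sat-ReachF : ∀ k {m} → m ≤ 2 ^ k → ∀ {K} (ρ : Fin K → Vertex G) u v x y →
               Sat G (ReachF k m β u v x y) ρ ⇔ Reach (E (ρ u) (ρ v)) m (ρ x) (ρ y)
  Sat-ReachF zero {zero}        _        ρ u v x y = ⇔-sym Reach-zero
  Sat-ReachF zero {suc zero}    _        ρ u v x y =
    ⇔-trans (⇔-refl ⊎-⇔ Sat-β ρ u v x y) (⇔-sym Reach-one)
  Sat-ReachF zero {suc (suc m)} (s≤s ())
  Sat-ReachF (suc k) {m} m≤2^[1+k] ρ u v x y =
    ⇔-trans (congˡ {k = equivalence} λ {z} →
               Sat-ReachF k (≤-trans (⌊n/2⌋≤⌈n/2⌉ m) ⌈m/2⌉≤2^k) (extend z ρ) _ _ _ _ ×-⇔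
               Sat-ReachF k ⌈m/2⌉≤2^k (extend z ρ) _ _ _ _)
            (⇔-sym (Reach-halves m))
    where
    ⌈m/2⌉≤2^k : ⌈ m /2⌉ ≤ 2 ^ k
    ⌈m/2⌉≤2^k = m≤2^[1+k]⇒⌈m/2⌉≤2^k k m≤2^[1+k]

module _ (G : Graph) where

  Adj-sym : Sym (Adj G) (Adj G)
  Adj-sym {x} {y} = subst T (Graph.sym G x y)

  Adj-irrefl : ∀ {x y} → Adj G x y → x ≢ y
  Adj-irrefl {x} xx refl = irrefl G x xx

  adj? : Decidable (Adj G)
  adj? x y = T? (adj G x y)

  Walk⇒Star : ∀ {x y} → Walk G x y → Star (Adj G) x y
  Walk⇒Star here       = ε
  Walk⇒Star (step e w) = e ◅ Walk⇒Star w

  Star⇒Walk : ∀ {x y} → Star (Adj G) x y → Walk G x y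
  Star⇒Walk ε       = here
  Star⇒Walk (e ◅ w) = step e (Star⇒Walk w)

  AdjWithout : Vertex G → Vertex G → Rel (Vertex G) 0ℓ
  AdjWithout u v x y = Adj G x y × ¬ ((x ≡ u × y ≡ v) ⊎ (x ≡ v × y ≡ u))

  AdjWithout-sym : ∀ {u v} → Sym (AdjWithout u v) (AdjWithout u v)
  AdjWithout-sym (xy , xy≢uv) = Adj-sym xy , λ
    { (inj₁ (y≡u , x≡v)) → xy≢uv (inj₂ (x≡v , y≡u))
    ; (inj₂ (y≡v , x≡u)) → xy≢uv (inj₁ (x≡u , y≡v)) }

  AdjWithout-avoidingˡ : ∀ {u v x y} → Adj G x y → x ≢ u → y ≢ u → AdjWithout u v x y
  AdjWithout-avoidingˡ xy x≢u y≢u =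
    xy , λ { (inj₁ (x≡u , _)) → x≢u x≡u ; (inj₂ (_ , y≡u)) → y≢u y≡u }

  AdjWithout-avoidingʳ : ∀ {u v x y} → Adj G x y → x ≢ v → y ≢ v → AdjWithout u v x y
  AdjWithout-avoidingʳ xy x≢v y≢v =
    xy , λ { (inj₁ (_ , y≡v)) → y≢v y≡v ; (inj₂ (x≡v , _)) → x≢v x≡v }

  AdjWithout-other : ∀ {x a b} → Adj G x a → a ≢ b → AdjWithout x b x a
  AdjWithout-other xa a≢b =
    xa , λ { (inj₁ (_ , a≡b)) → a≢b a≡b ; (inj₂ (_ , a≡x)) → Adj-irrefl xa (sym a≡x) }

  simple-cycle : ∀ {E} → E ⇒ Adj G → ∀ {s t} (w : Star E s t) → Simple w → 2 ≤ length w →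
                 Adj G t s → Cycle G
  simple-cycle _ (_ ◅ ε) _ (s≤s ()) _
  simple-cycle E⊆Adj w@(_ ◅ _ ◅ w′) simple _ ts = record
    { len-3  = length w′
    ; vert   = vertexAt w
    ; inj    = vertexAt-injective w simple
    ; edges  = λ i → E⊆Adj (vertexAt-step w i)
    ; closes = subst (λ z → Adj G z _) (sym (vertexAt-last w)) ts
    }

  acyclic⇒bridge : Acyclic G → ∀ {u v} → Adj G u v → ¬ Star (AdjWithout u v) u v
  acyclic⇒bridge acyclic uv w with simplify w
  ... | ε , _ = Adj-irrefl uv refl
  ... | (_ , uv∉) ◅ ε , _ = uv∉ (inj₁ (refl , refl))
  ... | p@(_ ◅ _ ◅ _) , simple =
    acyclic (simple-cycle proj₁ p simple (s≤s (s≤s z≤n)) (Adj-sym uv))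

  cycle-neighbours : (C : Cycle G) (j : Fin (3 + len-3 C)) →
                     ∃ λ a → ∃ λ b → a ≢ b × Adj G (vert C j) (vert C a)
                                           × Adj G (vert C j) (vert C b)
  cycle-neighbours C j with view j
  ... | ‵fromℕ =
    inject₁ (fromℕ _) , zero , (λ ()) , Adj-sym (edges C (fromℕ _)) , closes C
  ... | ‵inj₁ {i = zero} _ =
    suc zero , fromℕ _ , (λ ()) , edges C zero , Adj-sym (closes C)
  ... | ‵inj₁ {i = suc i} _ =
    suc (suc i) , inject₁ (inject₁ i) , suc²≢inject₁² i ,
    edges C (suc i) , Adj-sym (edges C (inject₁ i))

  NoShortDetour : ℕ → Set
  NoShortDetour M = ∀ x y → Adj G x y → ¬ Reach (AdjWithout x y) M x y

  acyclic⇒NoShortDetour : Acyclic G → ∀ M → NoShortDetour M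
  acyclic⇒NoShortDetour acyclic M x y xy (w , _) = acyclic⇒bridge acyclic xy w

  Radius≤ : ℕ → Set
  Radius≤ e = ∃ λ c → ∀ x → Reach (Adj G) e c x

  Radius≤? : ∀ e → Dec (Radius≤ e)
  Radius≤? e = any? λ c → all? λ x → reach? adj? e c x

  Radius≤-mono : ∀ {e e′} → e ≤ e′ → Radius≤ e → Radius≤ e′
  Radius≤-mono e≤e′ (c , c↝) = c , Reach-mono e≤e′ ∘ c↝

  connected⇒Radius≤order : Connected G → Vertex G → Radius≤ (order G)
  connected⇒Radius≤order connected c = c , λ x →
    let w , simple = simplify (Walk⇒Star (connected c x))
    in w , <⇒≤ (simple-length< w simple)

  bridge-separates : Acyclic G → ∀ {c c′ x₁ x₂} → Adj G c c′ →
                     (w₁ : Star (Adj G) c′ x₁) → ¬ Visits w₁ c →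
                     (w₂ : Star (Adj G) c x₂) → ¬ Visits w₂ c′ →
                     (w : Star (Adj G) x₁ x₂) → Visits w c
  bridge-separates acyclic cc′ w₁ c∉w₁ w₂ c′∉w₂ w = decidable-stable (visits? w _) λ c∉w →
    acyclic⇒bridge acyclic (Adj-sym cc′)
      (restrict AdjWithout-avoidingʳ w₁ c∉w₁ ◅◅ restrict AdjWithout-avoidingʳ w c∉w ◅◅
       reverse AdjWithout-sym (restrict AdjWithout-avoidingˡ w₂ c′∉w₂))

  diameter-bound : Acyclic G → Connected G → ∀ {e c c′ x₁ x₂} → Adj G c c′ →
                   ¬ Reach (Adj G) e c x₁ → Reach (Adj G) e c′ x₁ →
                   ¬ Reach (Adj G) e c′ x₂ → Reach (Adj G) (suc e) c x₂ →
                   2 * suc e ≤ order G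
  diameter-bound acyclic connected {e} {c} {c′} {x₁} {x₂}
                 cc′ c↛x₁ (w₁ , |w₁|≤e) c′↛x₂ (w₂ , |w₂|≤1+e) =
    let w , simple = simplify (Walk⇒Star (connected x₁ x₂))
    in ≤-trans (through-c w (bridge-separates acyclic cc′ w₁ c∉w₁ w₂ c′∉w₂ w))
               (simple-length< w simple)
    where
    c∉w₁ : ¬ Visits w₁ c
    c∉w₁ c∈w₁ = let q , |q|≤|w₁| = suffix w₁ c∈w₁
                in c↛x₁ (q , ≤-trans |q|≤|w₁| |w₁|≤e)

    c′∉w₂ : ¬ Visits w₂ c′
    c′∉w₂ c′∈w₂ =
      let q , |q|<|w₂| = proper-suffix (Adj-irrefl cc′) w₂ c′∈w₂
      in c′↛x₂ (q , ≤-pred (≤-trans |q|<|w₂| |w₂|≤1+e))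

    far-from-c : (p : Star (Adj G) x₁ c) → e < length p
    far-from-c p = ≰⇒> λ |p|≤e → c↛x₁ (Reach-reverse Adj-sym (p , |p|≤e))

    far-from-c′ : (q : Star (Adj G) c x₂) → e ≤ length q
    far-from-c′ q = ≤-pred (≰⇒> λ 1+|q|≤e → c′↛x₂ (Adj-sym cc′ ◅ q , 1+|q|≤e))

    through-c : (w : Star (Adj G) x₁ x₂) → Visits w c → 2 * suc e ≤ suc (length w)
    through-c w c∈w = let p , q , |p|+|q| = splitAt w c∈w in begin
      2 * suc e                 ≡⟨ cong (suc e +_) (+-identityʳ (suc e)) ⟩
      suc e + suc e             ≤⟨ +-mono-≤ (far-from-c p) (s≤s (far-from-c′ q)) ⟩
      length p + suc (length q) ≡⟨ +-suc (length p) (length q) ⟩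
      suc (length p + length q) ≡⟨ cong suc |p|+|q| ⟩
      suc (length w)            ∎
      where open ≤-Reasoning

  tree-radius : IsTree G → ∃ λ e → 2 * e ≤ order G × Radius≤ e
  tree-radius (n≥1 , connected , acyclic) =
    radius-of (minimum Radius≤? Radius≤-mono
                (connected⇒Radius≤order connected (fromℕ< n≥1)))
    where
    radius-of : Minimum Radius≤ → ∃ λ e → 2 * e ≤ order G × Radius≤ e
    radius-of record { min = zero ; holds = radius } = 0 , z≤n , radius
    radius-of record { min = suc e ; holds = c , c↝ ; least = minimal } =
      let x₁ , c↛x₁        = far c
          c′ , cc′ , c′↝x₁ = Reach-uncons (c↝ x₁) c↛x₁
          x₂ , c′↛x₂       = far c′
      in suc e , diameter-bound acyclic connected cc′ c↛x₁ c′↝x₁ c′↛x₂ (c↝ x₂) , c , c↝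
      where
      far : ∀ c′ → ∃ λ x → ¬ Reach (Adj G) e c′ x
      far c′ = ¬∀⟶∃¬ _ _ (reach? adj? e c′) λ c′↝ → 1+n≰n (minimal (c′ , c′↝))

  tree⇒Radius≤ : IsTree G → Radius≤ (pred (2 ^ ⌊log₂ order G ⌋))
  tree⇒Radius≤ tree = let e , 2e≤n , radius = tree-radius tree
                       in Radius≤-mono (2*m≤n⇒m≤pred[2^⌊log₂n⌋] 2e≤n) radius

  short-detour : ∀ {c x a b} (dist : ∀ y → Distance c y) → Adj G x a → Adj G x b → a ≢ b →
                 min (dist a) ≤ min (dist x) → min (dist b) ≤ min (dist x) →
                 Reach (AdjWithout x b) (suc (min (dist a) + min (dist b))) x b
  short-detour {c} {x} {a} {b} dist xa xb a≢b a≤x b≤x =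
    Reach-step (AdjWithout-other xa a≢b)
      (from (Reach-+ _) (c , Reach-reverse AdjWithout-sym (geodesic (Adj-irrefl xa) a≤x) ,
                             geodesic (Adj-irrefl xb) b≤x))
    where
    geodesic : ∀ {y} → x ≢ y → min (dist y) ≤ min (dist x) →
               Reach (AdjWithout x b) (min (dist y)) c y
    geodesic {y} x≢y y≤x =
      let w , |w|≤ = holds (dist y)
          x∉w      = geodesic-avoids (dist x) x≢y w (≤-trans |w|≤ y≤x)
      in restrict AdjWithout-avoidingˡ w x∉w ,
         subst (_≤ _) (sym (length-restrict AdjWithout-avoidingˡ w x∉w)) |w|≤

  Radius≤∧NoShortDetour⇒Acyclic : ∀ {R M} → suc (R + R) ≤ M → Radius≤ R → NoShortDetour M →
                                  Acyclic G
  Radius≤∧NoShortDetour⇒Acyclic {R} 1+2R≤M (c , c↝) no-detour C =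
    let a , b , a≢b , xa , xb = cycle-neighbours C peak
        detour = short-detour dist xa xb (a≢b ∘ inj C) (peak-highest a) (peak-highest b)
        1+da+db≤M = ≤-trans (s≤s (+-mono-≤ (dist≤R _) (dist≤R _))) 1+2R≤M
    in no-detour _ _ xb (Reach-mono 1+da+db≤M detour)
    where
    dist : ∀ y → Distance c y
    dist y = distance adj? (c↝ y)

    dist≤R : ∀ y → min (dist y) ≤ R
    dist≤R y = least (dist y) (c↝ y)

    height : Fin (3 + len-3 C) → ℕ
    height = min ∘ dist ∘ vert C

    peak : Fin (3 + len-3 C)
    peak = argmax height zero (allFin _)

    peak-highest : ∀ i → height i ≤ height peak
    peak-highest i = All.lookup (f[xs]≤f[argmax] {f = height} zero (allFin _)) (∈-allFin i)

  Radius≤∧NoShortDetour⇒IsTree : ∀ {R M} → suc (R + R) ≤ M → Radius≤ R → NoShortDetour M →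
                                 IsTree G
  Radius≤∧NoShortDetour⇒IsTree 1+2R≤M radius@(c , c↝) no-detour =
    >-nonZero⁻¹ _ {{nonZeroIndex c}} , connected ,
    Radius≤∧NoShortDetour⇒Acyclic 1+2R≤M radius no-detour
    where
    connected : Connected G
    connected u v = Star⇒Walk (reverse Adj-sym (proj₁ (c↝ u)) ◅◅ proj₁ (c↝ v))

adjβ : EdgeFormula
adjβ _ _ x y = adjF x y

adjWithoutβ : EdgeFormula
adjWithoutβ u v x y = adjF x y ∧F ¬F ((eq x u ∧F eq y v) ∨F (eq x v ∧F eq y u))

RadiusF : ℕ → ℕ → Sentence
RadiusF k R = ∃F (∀F (ReachF k R adjβ zero zero (suc zero) zero))

NoShortDetourF : ℕ → ℕ → Sentence
NoShortDetourF k M =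
  ∀F (∀F (adjF (suc zero) zero ⇒F ¬F (ReachF k M adjWithoutβ (suc zero) zero (suc zero) zero)))

depth-RadiusF : ∀ k R → depth (RadiusF k R) ≤ 2 + k
depth-RadiusF k R = s≤s (s≤s (depth-ReachF (λ _ _ _ _ → refl) k R _ _ _ _))

depth-NoShortDetourF : ∀ k M → depth (NoShortDetourF k M) ≤ 2 + k
depth-NoShortDetourF k M = s≤s (s≤s (depth-ReachF (λ _ _ _ _ → refl) k M _ _ _ _))

⊨RadiusF : ∀ G k {R} → R ≤ 2 ^ k → G ⊨ RadiusF k R ⇔ Radius≤ G R
⊨RadiusF G k R≤2^k = congˡ {k = equivalence} λ {c} → ∀-cong-⇔ λ x →
  Sat-ReachF G adjβ (λ _ _ → Adj G) (λ _ _ _ _ _ → ⇔-refl)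
             k R≤2^k (extend x (extend c emptyEnv)) _ _ _ _

⊨NoShortDetourF : ∀ G k {M} → M ≤ 2 ^ k → G ⊨ NoShortDetourF k M ⇔ NoShortDetour G M
⊨NoShortDetourF G k M≤2^k = ∀-cong-⇔ λ x → ∀-cong-⇔ λ y → →-cong-⇔ ⇔-refl (¬-cong-⇔
  (Sat-ReachF G adjWithoutβ (AdjWithout G) (λ _ _ _ _ _ → ⇔-refl)
              k M≤2^k (extend y (extend x emptyEnv)) _ _ _ _))

lemma3 : (T T′ : Graph) → IsTree T → ¬ IsTree T′ →
    D≤ T T′ (⌊log₂ order T ⌋ + 3)
lemma3 T T′ tree ¬tree′ = φ , depth≤d+3 , T⊨φ , T′⊭φ
  where
  d R M : ℕ
  d = ⌊log₂ order T ⌋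
  R = pred (2 ^ d)
  M = 2 ^ suc d

  φ : Sentence
  φ = RadiusF d R ∧F NoShortDetourF (suc d) M

  R≤2^d : R ≤ 2 ^ d
  R≤2^d = pred[n]≤n

  depth≤d+3 : depth φ ≤ d + 3
  depth≤d+3 = subst (depth φ ≤_) (+-comm 3 d)
                (⊔-lub (m≤n⇒m≤1+n (depth-RadiusF d R)) (depth-NoShortDetourF (suc d) M))

  T⊨φ : T ⊨ φ
  T⊨φ = from (⊨RadiusF T d R≤2^d) (tree⇒Radius≤ T tree) ,
        from (⊨NoShortDetourF T (suc d) ≤-refl)
             (acyclic⇒NoShortDetour T (proj₂ (proj₂ tree)) M)

  T′⊭φ : ¬ T′ ⊨ φ
  T′⊭φ (radius , no-detour) =
    ¬tree′ (Radius≤∧NoShortDetour⇒IsTree T′ (1+2*pred[n]≤2*n (m^n>0 2 d))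
              (to (⊨RadiusF T′ d R≤2^d) radius)
              (to (⊨NoShortDetourF T′ (suc d) ≤-refl) no-detour))
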